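{- Let $n\ge 0$ and $k\ge 1$ be integers. Then \[ D(n,k) = \sum_{\lambda\in\mathcal{P}_{n-k^2,k}} \prod_{i=1}^k \bigl( m_i(\lambda) +1 \bigr), \] where $\mathcal{P}_{N,r}$ is the set of all partitions of weight $N$ in which no part exceeds $r$ (empty if $N<0$), and $m_i(\lambda)$ is the number of parts of $\lambda$ equal to $i$.
   Context: A partition of $n$ is a nonincreasing finite sequence of positive integers summing to $n$. The Durfee square of a partition $\lambda$ is the largest square of dots, with its corner at the upper left, contained in the Ferrers graph of $\lambda$. Its order $k$ is its side length, equivalently the largest $k$ with $\lambda_k\ge k$. $D(n,k)$ denotes the number of partitions of $n$ whose Durfee square has order $k$. -}

module Defs where

open import Data.Nat using (ℕ; zero; suc; _+_; _*_; _≤_; _<_; _≟_)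
open import Data.List using (List; []; _∷_; map; length; filter; upTo)
open import Data.Nat.ListAction using (sum; product)
open import Data.List.Relation.Unary.All using (All)
open import Data.List.Relation.Unary.Linked using (Linked)
open import Data.Sum using (_⊎_)
open import Data.Product using (_×_)
open import Relation.Binary.PropositionalEquality using (_≡_)

IsPartitionOf : ℕ → List ℕ → Set
IsPartitionOf n λs = Linked (λ a b → b ≤ a) λs × All (λ x → 1 ≤ x) λs × sum λs ≡ n

-- part λ i = λ_i (1-indexed), with the usual convention λ_i = 0 beyond the length.
part : List ℕ → ℕ → ℕ
part []       _             = 0
part (x ∷ xs) zero          = 0
part (x ∷ xs) (suc zero)    = x
part (x ∷ xs) (suc (suc i)) = part xs (suc i)

-- The Durfee square of λ has order k: k is the largest k with λ_k ≥ k
-- (k = 0 allowed, corresponding to the empty square).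
DurfeeOrder : List ℕ → ℕ → Set
DurfeeOrder λs k = (k ≡ 0 ⊎ k ≤ part λs k) × (∀ j → j ≤ part λs j → j ≤ k)

mult : ℕ → List ℕ → ℕ
mult i λs = length (filter (_≟ i) λs)

weight : ℕ → List ℕ → ℕ
weight k λs = product (map (λ j → mult (suc j) λs + 1) (upTo k))

-- A partition λ of n with Durfee square k × k splits into the square, the arm to its
-- right (a partition with at most k parts, recorded by the multiplicity vector ds ∈ ℕᵏ of its
-- conjugate) and the leg below it (a partition with parts ≤ k, recorded by its multiplicity
-- vector vs ∈ ℕᵏ); then n = k² + Σᵢ i·(dsᵢ + vsᵢ).  The core of λ is the partition μ whose
-- multiplicity vector is ds + vs, so μ ∈ P_{n−k², k}.  Conversely, λ is determined by its
-- core μ together with ds, which may be any vector with 0 ≤ dsᵢ ≤ mᵢ(μ).  Hence the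
-- partitions with core μ form a fibre of size ∏ᵢ (mᵢ(μ) + 1), and D(n,k) is the sum of these.
module Submission where

open import Defs
open import Data.Nat using (ℕ; zero; suc; _+_; _*_; _∸_; _≤_; _<_; z≤n; s≤s; z<s; _≟_; _<?_; _≤?_)
open import Data.Nat.Properties
open import Data.Nat.ListAction using (sum; product)
open import Data.Nat.ListAction.Properties using (sum-++)
open import Data.List using (List; []; _∷_; [_]; _++_; length; map; filter; replicate; zipWith; take; drop; upTo; applyUpTo; concatMap; cartesianProductWith)
open import Data.List.Properties using (length-++; length-map; length-upTo; length-take; take++drop≡id; ∷-injective; map-applyUpTo; map-cong; filter-accept; filter-reject; filter-++; filter-none; filter-all; length-replicate)
open import Data.List.Relation.Unary.All as All using (All; []; _∷_)
import Data.List.Relation.Unary.All.Properties as All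
open import Data.List.Relation.Unary.AllPairs as AllPairs using (AllPairs; []; _∷_)
import Data.List.Relation.Unary.AllPairs.Properties as AllPairs
open import Data.List.Relation.Unary.Any using (here; there)
open import Data.List.Relation.Unary.Linked using (Linked)
import Data.List.Relation.Unary.Linked.Properties as Linked
open import Data.List.Relation.Unary.Unique.Propositional using (Unique)
import Data.List.Relation.Unary.Unique.Propositional.Properties as Unique
open import Data.List.Relation.Binary.Pointwise using (Pointwise; []; _∷_; Pointwise-length)
open import Data.List.Membership.Propositional using (_∈_; find; lose)
open import Data.List.Membership.Propositional.Properties using (∈-map⁺; ∈-map⁻; ∈-upTo⁺; ∈-upTo⁻; ∈-cartesianProductWith⁺; ∈-cartesianProductWith⁻; ∈-concatMap⁺; ∈-concatMap⁻)
open import Data.List.Membership.Propositional.Properties.WithK using (unique∧set⇒bag)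
open import Data.List.Relation.Binary.BagAndSetEquality using (∼bag⇒↭)
open import Data.List.Relation.Binary.Permutation.Propositional.Properties using (↭-length)
open import Data.Product using (_×_; Σ; _,_; proj₁; proj₂)
open import Data.Sum using (inj₁; inj₂)
open import Data.Empty using (⊥-elim)
open import Relation.Nullary using (¬_; yes; no)
open import Relation.Binary.PropositionalEquality using (_≡_; _≢_; refl; sym; trans; cong; cong₂; subst; module ≡-Reasoning)
open import Function using (_∘_)
open import Function.Bundles using (_⇔_; mk⇔; Equivalence)
import Function.Properties.Equivalence as Eq
open import Algebra.Properties.CommutativeSemigroup +-commutativeSemigroup using () renaming (interchange to +-interchange)

private
  variable
    A B C : Set

length-unique-≡ : {xs ys : List A} → Unique xs → Unique ys →
  (∀ {x} → x ∈ xs ⇔ x ∈ ys) → length xs ≡ length ys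
length-unique-≡ u v same = ↭-length (∼bag⇒↭ (unique∧set⇒bag u v same))

length-cartesianProductWith : (f : A → B → C) (xs : List A) (ys : List B) →
  length (cartesianProductWith f xs ys) ≡ length xs * length ys
length-cartesianProductWith f []       ys = refl
length-cartesianProductWith f (x ∷ xs) ys = begin
  length (map (f x) ys ++ cartesianProductWith f xs ys)
    ≡⟨ length-++ (map (f x) ys) ⟩
  length (map (f x) ys) + length (cartesianProductWith f xs ys)
    ≡⟨ cong₂ _+_ (length-map (f x) ys) (length-cartesianProductWith f xs ys) ⟩
  length ys + length xs * length ys ∎
  where open ≡-Reasoning

length-concatMap : (f : A → List B) (xs : List A) →
  length (concatMap f xs) ≡ sum (map (length ∘ f) xs)
length-concatMap f []       = refl
length-concatMap f (x ∷ xs) =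
  trans (length-++ (f x)) (cong (length (f x) +_) (length-concatMap f xs))

unique-map-on : {f : A → B} {xs : List A} → Unique xs →
  (∀ {a b} → a ∈ xs → b ∈ xs → f a ≡ f b → a ≡ b) → Unique (map f xs)
unique-map-on [] inj = []
unique-map-on (a∉ ∷ u) inj =
  All.map⁺ (All.tabulate (λ b∈ eq → All.lookup a∉ b∈ (inj (here refl) (there b∈) eq)))
  ∷ unique-map-on u (λ p q → inj (there p) (there q))

unique-concatMap : {f : A → List B} {xs : List A} → Unique xs →
  (∀ {a} → a ∈ xs → Unique (f a)) →
  (∀ {a a' y} → a ∈ xs → a' ∈ xs → y ∈ f a → y ∈ f a' → a ≡ a') →
  Unique (concatMap f xs)
unique-concatMap [] _ _ = []
unique-concatMap {f = f} {a ∷ xs} (a∉ ∷ u) unique-fibre disjoint =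
  Unique.++⁺ (unique-fibre (here refl))
    (unique-concatMap u (unique-fibre ∘ there) (λ p q → disjoint (there p) (there q)))
    apart
  where
  apart : ∀ {y} → ¬ (y ∈ f a × y ∈ concatMap f xs)
  apart (p , q) with a' , a'∈ , r ← find (∈-concatMap⁻ f q) =
    All.lookup a∉ a'∈ (disjoint (here refl) (there a'∈) p r)

box : List ℕ → List (List ℕ)
box []       = [ [] ]
box (m ∷ ms) = cartesianProductWith _∷_ (upTo (suc m)) (box ms)

length-box : ∀ ms → length (box ms) ≡ product (map suc ms)
length-box []       = refl
length-box (m ∷ ms) = begin
  length (cartesianProductWith _∷_ (upTo (suc m)) (box ms))
    ≡⟨ length-cartesianProductWith _∷_ (upTo (suc m)) (box ms) ⟩
  length (upTo (suc m)) * length (box ms)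
    ≡⟨ cong₂ _*_ (length-upTo (suc m)) (length-box ms) ⟩
  suc m * product (map suc ms) ∎
  where open ≡-Reasoning

∈-box⁺ : ∀ {d ms} → Pointwise _≤_ d ms → d ∈ box ms
∈-box⁺ []           = here refl
∈-box⁺ (d≤m ∷ d≤ms) = ∈-cartesianProductWith⁺ _∷_ (∈-upTo⁺ (s≤s d≤m)) (∈-box⁺ d≤ms)

∈-box⁻ : ∀ {d} ms → d ∈ box ms → Pointwise _≤_ d ms
∈-box⁻ []       (here refl) = []
∈-box⁻ (m ∷ ms) p with c , ds , c∈ , ds∈ , refl ← ∈-cartesianProductWith⁻ _∷_ (upTo (suc m)) (box ms) p =
  ≤-pred (∈-upTo⁻ c∈) ∷ ∈-box⁻ ms ds∈

unique-box : ∀ ms → Unique (box ms)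
unique-box []       = [] ∷ []
unique-box (m ∷ ms) = Unique.cartesianProductWith⁺ _∷_ ∷-injective (Unique.upTo⁺ (suc m)) (unique-box ms)

Decreasing : List ℕ → Set
Decreasing = AllPairs (λ a b → b ≤ a)

decreasing⇒linked : ∀ {xs} → Decreasing xs → Linked (λ a b → b ≤ a) xs
decreasing⇒linked = Linked.AllPairs⇒Linked

linked⇒decreasing : ∀ {xs} → Linked (λ a b → b ≤ a) xs → Decreasing xs
linked⇒decreasing = Linked.Linked⇒AllPairs (λ p q → ≤-trans q p)

replicate-decreasing : ∀ n x → Decreasing (replicate n x)
replicate-decreasing zero    x = []
replicate-decreasing (suc n) x = All.replicate⁺ n ≤-refl ∷ replicate-decreasing n x

mult-≡ : ∀ i xs → mult i (i ∷ xs) ≡ suc (mult i xs)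
mult-≡ i xs = cong length (filter-accept (_≟ i) refl)

mult-≢ : ∀ {i x} xs → x ≢ i → mult i (x ∷ xs) ≡ mult i xs
mult-≢ {i} xs x≢i = cong length (filter-reject (_≟ i) x≢i)

mult-++ : ∀ i xs ys → mult i (xs ++ ys) ≡ mult i xs + mult i ys
mult-++ i xs ys = trans (cong length (filter-++ (_≟ i) xs ys)) (length-++ (filter (_≟ i) xs))

mult-none : ∀ {i} xs → All (_≢ i) xs → mult i xs ≡ 0
mult-none xs none = cong length (filter-none (_≟ _) none)

mult-replicate : ∀ n i → mult i (replicate n i) ≡ n
mult-replicate n i = trans (cong length (filter-all (_≟ i) (All.replicate⁺ n refl))) (length-replicate n)

mult-replicate-≢ : ∀ n {i j} → i ≢ j → mult j (replicate n i) ≡ 0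
mult-replicate-≢ n i≢j = mult-none (replicate n _) (All.replicate⁺ n i≢j)

mults : ℕ → ℕ → List ℕ → List ℕ
mults i zero    μ = []
mults i (suc k) μ = mult i μ ∷ mults (suc i) k μ

length-mults : ∀ i k μ → length (mults i k μ) ≡ k
length-mults i zero    μ = refl
length-mults i (suc k) μ = cong suc (length-mults (suc i) k μ)

mults-cong : ∀ i k {μ ν} → (∀ j → i ≤ j → mult j μ ≡ mult j ν) → mults i k μ ≡ mults i k ν
mults-cong i zero    same = refl
mults-cong i (suc k) same = cong₂ _∷_ (same i ≤-refl) (mults-cong (suc i) k (λ j i<j → same j (<⇒≤ i<j)))

expand : ℕ → List ℕ → List ℕ
expand i []       = []
expand i (v ∷ vs) = expand (suc i) vs ++ replicate v i

moment : ℕ → List ℕ → ℕ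
moment i []       = 0
moment i (v ∷ vs) = i * v + moment (suc i) vs

expand-bounds : ∀ i vs → All (λ y → i ≤ y × y < i + length vs) (expand i vs)
expand-bounds i []       = []
expand-bounds i (v ∷ vs) =
  All.++⁺ (All.map shift (expand-bounds (suc i) vs)) (All.replicate⁺ v (≤-refl , m<m+n i z<s))
  where
  shift : ∀ {y} → suc i ≤ y × y < suc i + length vs → i ≤ y × y < i + suc (length vs)
  shift {y} (i<y , y<) = <⇒≤ i<y , subst (y <_) (sym (+-suc i (length vs))) y<

expand-decreasing : ∀ i vs → Decreasing (expand i vs)
expand-decreasing i []       = []
expand-decreasing i (v ∷ vs) =
  AllPairs.++⁺ (expand-decreasing (suc i) vs) (replicate-decreasing v i)
    (All.map (λ bounds → All.replicate⁺ v (<⇒≤ (proj₁ bounds))) (expand-bounds (suc i) vs))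

sum-expand : ∀ i vs → sum (expand i vs) ≡ moment i vs
sum-expand i []       = refl
sum-expand i (v ∷ vs) = begin
  sum (expand (suc i) vs ++ replicate v i)  ≡⟨ sum-++ (expand (suc i) vs) (replicate v i) ⟩
  sum (expand (suc i) vs) + sum (replicate v i)
    ≡⟨ cong₂ _+_ (sum-expand (suc i) vs) (trans (sum-replicate v i) (*-comm v i)) ⟩
  moment (suc i) vs + i * v                 ≡⟨ +-comm (moment (suc i) vs) (i * v) ⟩
  i * v + moment (suc i) vs ∎
  where
  open ≡-Reasoning
  sum-replicate : ∀ n x → sum (replicate n x) ≡ n * x
  sum-replicate zero    x = refl
  sum-replicate (suc n) x = cong (x +_) (sum-replicate n x)

mults-expand : ∀ i vs → mults i (length vs) (expand i vs) ≡ vs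
mults-expand i []       = refl
mults-expand i (v ∷ vs) = cong₂ _∷_ head-mult tail-mults
  where
  rest : List ℕ
  rest = expand (suc i) vs
  head-mult : mult i (rest ++ replicate v i) ≡ v
  head-mult = begin
    mult i (rest ++ replicate v i)        ≡⟨ mult-++ i rest (replicate v i) ⟩
    mult i rest + mult i (replicate v i)
      ≡⟨ cong₂ _+_ (mult-none rest (All.map (λ b → >⇒≢ (proj₁ b)) (expand-bounds (suc i) vs))) (mult-replicate v i) ⟩
    v ∎
    where open ≡-Reasoning
  tail-mults : mults (suc i) (length vs) (rest ++ replicate v i) ≡ vs
  tail-mults = trans (mults-cong (suc i) (length vs) ignore-i) (mults-expand (suc i) vs)
    where
    ignore-i : ∀ j → suc i ≤ j → mult j (rest ++ replicate v i) ≡ mult j rest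
    ignore-i j i<j = trans (mult-++ j rest (replicate v i))
      (trans (cong (mult j rest +_) (mult-replicate-≢ v (<⇒≢ i<j))) (+-identityʳ _))

partsAbove : ℕ → List ℕ → List ℕ
partsAbove i = filter (i <?_)

mult-∷-cong : ∀ x {j ys zs} → mult j ys ≡ mult j zs → mult j (x ∷ ys) ≡ mult j (x ∷ zs)
mult-∷-cong x {j} {ys} {zs} same with x ≟ j
... | yes refl = trans (mult-≡ x ys) (trans (cong suc same) (sym (mult-≡ x zs)))
... | no x≢j   = trans (mult-≢ ys x≢j) (trans same (sym (mult-≢ zs x≢j)))

mult-partsAbove : ∀ {i j} xs → i < j → mult j (partsAbove i xs) ≡ mult j xs
mult-partsAbove          []       i<j = refl
mult-partsAbove {i} {j} (x ∷ xs) i<j with i <? x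
... | yes i<x = trans (cong (mult j) (filter-accept (i <?_) i<x)) (mult-∷-cong x (mult-partsAbove xs i<j))
... | no i≮x  = trans (cong (mult j) (filter-reject (i <?_) i≮x))
                  (trans (mult-partsAbove xs i<j) (sym (mult-≢ xs x≢j)))
  where
  x≢j : x ≢ j
  x≢j refl = i≮x i<j

split-at : ∀ i μ → Decreasing μ → All (i ≤_) μ → μ ≡ partsAbove i μ ++ replicate (mult i μ) i
split-at i []       _            _            = refl
split-at i (x ∷ μ) (x≥μ ∷ dec) (i≤x ∷ i≤μ) with i <? x
... | yes i<x = begin
  x ∷ μ                                             ≡⟨ cong (x ∷_) (split-at i μ dec i≤μ) ⟩
  x ∷ partsAbove i μ ++ replicate (mult i μ) i
    ≡⟨ cong₂ (λ ys m → ys ++ replicate m i) (sym (filter-accept (i <?_) i<x)) (sym (mult-≢ μ (>⇒≢ i<x))) ⟩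
  partsAbove i (x ∷ μ) ++ replicate (mult i (x ∷ μ)) i ∎
  where open ≡-Reasoning
... | no i≮x with refl ← ≤-antisym i≤x (≮⇒≥ i≮x) = begin
  i ∷ μ                                             ≡⟨ cong (i ∷_) (split-at i μ dec i≤μ) ⟩
  i ∷ partsAbove i μ ++ replicate (mult i μ) i
    ≡⟨ cong (λ ys → i ∷ ys ++ replicate (mult i μ) i) nothing-above ⟩
  replicate (suc (mult i μ)) i                      ≡⟨ cong (λ m → replicate m i) (sym (mult-≡ i μ)) ⟩
  replicate (mult i (i ∷ μ)) i
    ≡⟨ cong (_++ replicate (mult i (i ∷ μ)) i) (sym (trans (filter-reject (i <?_) i≮x) nothing-above)) ⟩
  partsAbove i (i ∷ μ) ++ replicate (mult i (i ∷ μ)) i ∎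
  where
  open ≡-Reasoning
  nothing-above : partsAbove i μ ≡ []
  nothing-above = filter-none (i <?_) (All.map ≤⇒≯ x≥μ)

expand-mults : ∀ i k μ → Decreasing μ → All (λ y → i ≤ y × y < i + k) μ → expand i (mults i k μ) ≡ μ
expand-mults i zero    []      _   _ = refl
expand-mults i zero    (x ∷ μ) _   ((i≤x , x<i+0) ∷ _) = ⊥-elim (<⇒≱ x<i+0 (subst (_≤ x) (sym (+-identityʳ i)) i≤x))
expand-mults i (suc k) μ       dec bounds = begin
  expand (suc i) (mults (suc i) k μ) ++ replicate (mult i μ) i
    ≡⟨ cong (λ v → expand (suc i) v ++ copies) (mults-cong (suc i) k (λ j i<j → sym (mult-partsAbove μ i<j))) ⟩
  expand (suc i) (mults (suc i) k above) ++ copies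
    ≡⟨ cong (_++ copies) (expand-mults (suc i) k above (AllPairs.filter⁺ (i <?_) dec) above-bounds) ⟩
  above ++ copies
    ≡⟨ sym (split-at i μ dec (All.map proj₁ bounds)) ⟩
  μ ∎
  where
  open ≡-Reasoning
  above copies : List ℕ
  above  = partsAbove i μ
  copies = replicate (mult i μ) i
  above-bounds : All (λ y → suc i ≤ y × y < suc i + k) above
  above-bounds = All.map (λ {y} (i<y , _ , y<) → i<y , subst (y <_) (+-suc i k) y<)
                   (All.zip (All.all-filter (i <?_) μ , All.filter⁺ (i <?_) bounds))

head0 : List ℕ → ℕ
head0 []      = 0
head0 (x ∷ _) = x

head0-≤ : ∀ {x xs} → All (_≤ x) xs → head0 xs ≤ x
head0-≤ []      = z≤n
head0-≤ (p ∷ _) = p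

decreasing-≤-head0 : ∀ {c} xs → Decreasing xs → head0 xs ≤ c → All (_≤ c) xs
decreasing-≤-head0 []       _          _  = []
decreasing-≤-head0 (x ∷ xs) (x≥xs ∷ _) x≤c = x≤c ∷ All.map (λ y≤x → ≤-trans y≤x x≤c) x≥xs

-- Conjugation for partitions with at most k parts, in multiplicity form:
-- a decreasing list t of length k (padded with zeros) corresponds to its gap vector
-- dᵢ = tᵢ − tᵢ₊₁ (the multiplicities of the conjugate), and t is recovered as suffix sums of d.
suffixSums : List ℕ → List ℕ
suffixSums []       = []
suffixSums (d ∷ ds) = (d + sum ds) ∷ suffixSums ds

gaps : List ℕ → List ℕ
gaps []       = []
gaps (t ∷ ts) = (t ∸ head0 ts) ∷ gaps ts

length-suffixSums : ∀ ds → length (suffixSums ds) ≡ length ds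
length-suffixSums []       = refl
length-suffixSums (d ∷ ds) = cong suc (length-suffixSums ds)

length-gaps : ∀ ts → length (gaps ts) ≡ length ts
length-gaps []       = refl
length-gaps (t ∷ ts) = cong suc (length-gaps ts)

head0-suffixSums : ∀ ds → head0 (suffixSums ds) ≡ sum ds
head0-suffixSums []      = refl
head0-suffixSums (_ ∷ _) = refl

gaps-suffixSums : ∀ ds → gaps (suffixSums ds) ≡ ds
gaps-suffixSums []       = refl
gaps-suffixSums (d ∷ ds) =
  cong₂ _∷_ (trans (cong (d + sum ds ∸_) (head0-suffixSums ds)) (m+n∸n≡m d (sum ds))) (gaps-suffixSums ds)

sum-gaps : ∀ ts → Decreasing ts → sum (gaps ts) ≡ head0 ts
sum-gaps []       _             = refl
sum-gaps (t ∷ ts) (t≥ts ∷ dec) =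
  trans (cong ((t ∸ head0 ts) +_) (sum-gaps ts dec)) (m∸n+n≡m (head0-≤ t≥ts))

suffixSums-gaps : ∀ ts → Decreasing ts → suffixSums (gaps ts) ≡ ts
suffixSums-gaps []       _             = refl
suffixSums-gaps (t ∷ ts) (t≥ts ∷ dec) =
  cong₂ _∷_ (sum-gaps (t ∷ ts) (t≥ts ∷ dec)) (suffixSums-gaps ts dec)

suffixSums-≤-sum : ∀ ds → All (_≤ sum ds) (suffixSums ds)
suffixSums-≤-sum []       = []
suffixSums-≤-sum (d ∷ ds) = ≤-refl ∷ All.map (λ p → ≤-trans p (m≤n+m (sum ds) d)) (suffixSums-≤-sum ds)

suffixSums-decreasing : ∀ ds → Decreasing (suffixSums ds)
suffixSums-decreasing []       = []
suffixSums-decreasing (d ∷ ds) =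
  All.map (λ p → ≤-trans p (m≤n+m (sum ds) d)) (suffixSums-≤-sum ds) ∷ suffixSums-decreasing ds

moment-suc : ∀ i vs → moment (suc i) vs ≡ sum vs + moment i vs
moment-suc i []       = refl
moment-suc i (v ∷ vs) = begin
  suc i * v + moment (suc (suc i)) vs      ≡⟨ cong (suc i * v +_) (moment-suc (suc i) vs) ⟩
  (v + i * v) + (sum vs + moment (suc i) vs) ≡⟨ +-interchange v (i * v) (sum vs) (moment (suc i) vs) ⟩
  (v + sum vs) + (i * v + moment (suc i) vs) ∎
  where open ≡-Reasoning

sum-suffixSums : ∀ ds → sum (suffixSums ds) ≡ moment 1 ds
sum-suffixSums []       = refl
sum-suffixSums (d ∷ ds) = begin
  (d + sum ds) + sum (suffixSums ds)  ≡⟨ cong ((d + sum ds) +_) (sum-suffixSums ds) ⟩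
  (d + sum ds) + moment 1 ds          ≡⟨ +-assoc d (sum ds) (moment 1 ds) ⟩
  d + (sum ds + moment 1 ds)          ≡⟨ cong₂ _+_ (sym (*-identityˡ d)) (sym (moment-suc 1 ds)) ⟩
  1 * d + moment 2 ds ∎
  where open ≡-Reasoning

moment-+ : ∀ i ds vs → length ds ≡ length vs → moment i (zipWith _+_ ds vs) ≡ moment i ds + moment i vs
moment-+ i []       []       _   = refl
moment-+ i (d ∷ ds) (v ∷ vs) len = begin
  i * (d + v) + moment (suc i) (zipWith _+_ ds vs)
    ≡⟨ cong₂ _+_ (*-distribˡ-+ i d v) (moment-+ (suc i) ds vs (suc-injective len)) ⟩
  (i * d + i * v) + (moment (suc i) ds + moment (suc i) vs)
    ≡⟨ +-interchange (i * d) (i * v) (moment (suc i) ds) (moment (suc i) vs) ⟩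
  (i * d + moment (suc i) ds) + (i * v + moment (suc i) vs) ∎
  where open ≡-Reasoning

zipWith-+-∸ : ∀ {ds ms} → Pointwise _≤_ ds ms → zipWith _+_ ds (zipWith _∸_ ms ds) ≡ ms
zipWith-+-∸ []           = refl
zipWith-+-∸ (d≤m ∷ d≤ms) = cong₂ _∷_ (m+[n∸m]≡n d≤m) (zipWith-+-∸ d≤ms)

zipWith-∸-+ : ∀ ds vs → length ds ≡ length vs → zipWith _∸_ (zipWith _+_ ds vs) ds ≡ vs
zipWith-∸-+ []       []       _   = refl
zipWith-∸-+ (d ∷ ds) (v ∷ vs) len = cong₂ _∷_ (m+n∸m≡n d v) (zipWith-∸-+ ds vs (suc-injective len))

≤-zipWith-+ : ∀ ds vs → length ds ≡ length vs → Pointwise _≤_ ds (zipWith _+_ ds vs)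
≤-zipWith-+ []       []       _   = []
≤-zipWith-+ (d ∷ ds) (v ∷ vs) len = m≤m+n d v ∷ ≤-zipWith-+ ds vs (suc-injective len)

length-zipWith-+ : ∀ ds vs → length ds ≡ length vs → length (zipWith _+_ ds vs) ≡ length ds
length-zipWith-+ []       []       _   = refl
length-zipWith-+ (d ∷ ds) (v ∷ vs) len = cong suc (length-zipWith-+ ds vs (suc-injective len))

length-zipWith-∸ : ∀ {ds ms} → Pointwise _≤_ ds ms → length (zipWith _∸_ ms ds) ≡ length ds
length-zipWith-∸ []      = refl
length-zipWith-∸ (_ ∷ p) = cong suc (length-zipWith-∸ p)

part-pos⇒≤length : ∀ xs j → 1 ≤ part xs j → j ≤ length xs
part-pos⇒≤length (x ∷ xs) (suc zero)    _   = s≤s z≤n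
part-pos⇒≤length (x ∷ xs) (suc (suc j)) pos = s≤s (part-pos⇒≤length xs (suc j) pos)

part-++ˡ : ∀ xs ys j → 1 ≤ j → j ≤ length xs → part (xs ++ ys) j ≡ part xs j
part-++ˡ (x ∷ xs) ys (suc zero)    _ _         = refl
part-++ˡ (x ∷ xs) ys (suc (suc j)) _ (s≤s j≤) = part-++ˡ xs ys (suc j) (s≤s z≤n) j≤

part-≥ : ∀ {c} xs j → All (c ≤_) xs → 1 ≤ j → j ≤ length xs → c ≤ part xs j
part-≥ (x ∷ xs) (suc zero)    (c≤x ∷ _)  _ _         = c≤x
part-≥ (x ∷ xs) (suc (suc j)) (_ ∷ c≤xs) _ (s≤s j≤) = part-≥ xs (suc j) c≤xs (s≤s z≤n) j≤

part-≤ : ∀ {c} ys j → All (_≤ c) ys → part ys j ≤ c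
part-≤ []       j             _          = z≤n
part-≤ (y ∷ ys) zero          _          = z≤n
part-≤ (y ∷ ys) (suc zero)    (y≤c ∷ _)  = y≤c
part-≤ (y ∷ ys) (suc (suc j)) (_ ∷ ys≤c) = part-≤ ys (suc j) ys≤c

part-++ʳ-≤ : ∀ {c} xs ys j → All (_≤ c) ys → length xs < j → part (xs ++ ys) j ≤ c
part-++ʳ-≤ []       ys j             ys≤c _          = part-≤ ys j ys≤c
part-++ʳ-≤ (x ∷ xs) ys (suc (suc j)) ys≤c (s≤s len<) = part-++ʳ-≤ xs ys (suc j) ys≤c len<

head0-drop : ∀ k xs → head0 (drop k xs) ≡ part xs (suc k)
head0-drop zero    []       = refl
head0-drop zero    (x ∷ xs) = refl
head0-drop (suc k) []       = refl
head0-drop (suc k) (x ∷ xs) = head0-drop k xs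

take-≥-part : ∀ {c} xs j → Decreasing xs → c ≤ part xs j → All (c ≤_) (take j xs)
take-≥-part xs           zero          _ _ = []
take-≥-part []           (suc j)       _ _ = []
take-≥-part (x ∷ xs)     (suc zero)    _ c≤x = c≤x ∷ []
take-≥-part (x ∷ [])     (suc (suc j)) _ z≤n = z≤n ∷ []
take-≥-part (x ∷ y ∷ xs) (suc (suc j)) (x≥ ∷ dec) c≤ with take-≥-part (y ∷ xs) (suc j) dec c≤
... | c≤y ∷ rest = ≤-trans c≤y (All.head x≥) ∷ c≤y ∷ rest

durfee-of-blocks : ∀ {k} T β → 1 ≤ k → length T ≡ k → All (k ≤_) T → All (_≤ k) β →
  DurfeeOrder (T ++ β) k
durfee-of-blocks {k} T β k≥1 lenT T≥k β≤k = inj₂ square , maximal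
  where
  k≤len : k ≤ length T
  k≤len = ≤-reflexive (sym lenT)
  square : k ≤ part (T ++ β) k
  square = subst (k ≤_) (sym (part-++ˡ T β k k≥1 k≤len)) (part-≥ T k T≥k k≥1 k≤len)
  maximal : ∀ j → j ≤ part (T ++ β) j → j ≤ k
  maximal j j≤λⱼ with j ≤? k
  ... | yes j≤k = j≤k
  ... | no  j≰k = ⊥-elim (j≰k (≤-trans j≤λⱼ (part-++ʳ-≤ T β j β≤k (subst (_< j) (sym lenT) (≰⇒> j≰k)))))

blocks-of-durfee : ∀ {k λs} → 1 ≤ k → Decreasing λs → DurfeeOrder λs k →
  length (take k λs) ≡ k × All (k ≤_) (take k λs) × All (_≤ k) (drop k λs)
blocks-of-durfee {k} {λs} k≥1 dec (inj₁ refl , _) = ⊥-elim (1+n≰n k≥1)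
blocks-of-durfee {k} {λs} k≥1 dec (inj₂ square , maximal) =
  trans (length-take k λs) (m≤n⇒m⊓n≡m k≤len) ,
  take-≥-part λs k dec square ,
  decreasing-≤-head0 (drop k λs) (AllPairs.drop⁺ k dec) (subst (_≤ k) (sym (head0-drop k λs)) next≤k)
  where
  k≤len : k ≤ length λs
  k≤len = part-pos⇒≤length λs k (≤-trans k≥1 square)
  next≤k : part λs (suc k) ≤ k
  next≤k with suc k ≤? part λs (suc k)
  ... | yes k<λₖ₊₁ = ⊥-elim (1+n≰n (maximal (suc k) k<λₖ₊₁))
  ... | no  k≮λₖ₊₁ = ≤-pred (≰⇒> k≮λₖ₊₁)

expand-partition : ∀ vs → IsPartitionOf (moment 1 vs) (expand 1 vs) × All (_≤ length vs) (expand 1 vs)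
expand-partition vs =
  (decreasing⇒linked (expand-decreasing 1 vs) , All.map proj₁ bounds , sum-expand 1 vs) ,
  All.map (λ { (_ , s≤s y≤) → y≤ }) bounds
  where
  bounds : All (λ y → 1 ≤ y × y < 1 + length vs) (expand 1 vs)
  bounds = expand-bounds 1 vs

expand-mults-partition : ∀ {N k μ} → IsPartitionOf N μ → All (_≤ k) μ →
  expand 1 (mults 1 k μ) ≡ μ × moment 1 (mults 1 k μ) ≡ N
expand-mults-partition {N} {k} {μ} (linked , positive , sumμ) μ≤k =
  recovered , trans (sym (sum-expand 1 (mults 1 k μ))) (trans (cong sum recovered) sumμ)
  where
  recovered : expand 1 (mults 1 k μ) ≡ μ
  recovered = expand-mults 1 k μ (linked⇒decreasing linked)
                (All.zipWith (λ (1≤y , y≤k) → 1≤y , s≤s y≤k) (positive , μ≤k))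

-- The Durfee decomposition, read backwards: the k × k square, the arm to its right given by
-- the multiplicity vector ds of its conjugate, and the leg below it given by its multiplicity vector vs.
glue : ℕ → List ℕ → List ℕ → List ℕ
glue k ds vs = map (k +_) (suffixSums ds) ++ expand 1 vs

sum-glue : ∀ k ds vs → length ds ≡ k → sum (glue k ds vs) ≡ k * k + (moment 1 ds + moment 1 vs)
sum-glue k ds vs len = begin
  sum (map (k +_) (suffixSums ds) ++ expand 1 vs)
    ≡⟨ sum-++ (map (k +_) (suffixSums ds)) (expand 1 vs) ⟩
  sum (map (k +_) (suffixSums ds)) + sum (expand 1 vs)
    ≡⟨ cong₂ _+_ (sum-map-+ (suffixSums ds)) (sum-expand 1 vs) ⟩
  (length (suffixSums ds) * k + sum (suffixSums ds)) + moment 1 vs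
    ≡⟨ cong₂ (λ l s → (l * k + s) + moment 1 vs) (trans (length-suffixSums ds) len) (sum-suffixSums ds) ⟩
  (k * k + moment 1 ds) + moment 1 vs
    ≡⟨ +-assoc (k * k) (moment 1 ds) (moment 1 vs) ⟩
  k * k + (moment 1 ds + moment 1 vs) ∎
  where
  open ≡-Reasoning
  sum-map-+ : ∀ xs → sum (map (k +_) xs) ≡ length xs * k + sum xs
  sum-map-+ []       = refl
  sum-map-+ (x ∷ xs) = trans (cong ((k + x) +_) (sum-map-+ xs)) (+-interchange k x (length xs * k) (sum xs))

length-shifted-arm : ∀ k ds → length ds ≡ k → length (map (k +_) (suffixSums ds)) ≡ k
length-shifted-arm k ds len = trans (length-map (k +_) (suffixSums ds)) (trans (length-suffixSums ds) len)

glue-durfee : ∀ {k} ds vs → 1 ≤ k → length ds ≡ k → length vs ≡ k →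
  IsPartitionOf (k * k + (moment 1 ds + moment 1 vs)) (glue k ds vs) × DurfeeOrder (glue k ds vs) k
glue-durfee {k} ds vs k≥1 lends lenvs =
  (decreasing⇒linked decreasing , positive , sum-glue k ds vs lends) ,
  durfee-of-blocks arm leg k≥1 (length-shifted-arm k ds lends) arm≥k leg≤k
  where
  arm leg : List ℕ
  arm = map (k +_) (suffixSums ds)
  leg = expand 1 vs
  arm≥k : All (k ≤_) arm
  arm≥k = All.map⁺ (All.tabulate (λ {x} _ → m≤m+n k x))
  leg-partition : IsPartitionOf (moment 1 vs) leg × All (_≤ length vs) leg
  leg-partition = expand-partition vs
  leg≤k : All (_≤ k) leg
  leg≤k = subst (λ l → All (_≤ l) leg) lenvs (proj₂ leg-partition)
  positive : All (1 ≤_) (arm ++ leg)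
  positive = All.++⁺ (All.map (≤-trans k≥1) arm≥k) (proj₁ (proj₂ (proj₁ leg-partition)))
  decreasing : Decreasing (arm ++ leg)
  decreasing = AllPairs.++⁺ (AllPairs.map⁺ (AllPairs.map (+-monoʳ-≤ k) (suffixSums-decreasing ds)))
                 (linked⇒decreasing (proj₁ (proj₁ leg-partition)))
                 (All.map (λ k≤a → All.map (λ y≤k → ≤-trans y≤k k≤a) leg≤k) arm≥k)

take-length-++ : ∀ (xs ys : List A) → take (length xs) (xs ++ ys) ≡ xs
take-length-++ []       ys = refl
take-length-++ (x ∷ xs) ys = cong (x ∷_) (take-length-++ xs ys)

drop-length-++ : ∀ (xs ys : List A) → drop (length xs) (xs ++ ys) ≡ ys
drop-length-++ []       ys = refl
drop-length-++ (x ∷ xs) ys = drop-length-++ xs ys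

map-+-∸ : ∀ k xs → All (k ≤_) xs → map (k +_) (map (_∸ k) xs) ≡ xs
map-+-∸ k []       []           = refl
map-+-∸ k (x ∷ xs) (k≤x ∷ k≤xs) = cong₂ _∷_ (m+[n∸m]≡n k≤x) (map-+-∸ k xs k≤xs)

map-∸-+ : ∀ k xs → map (_∸ k) (map (k +_) xs) ≡ xs
map-∸-+ k []       = refl
map-∸-+ k (x ∷ xs) = cong₂ _∷_ (m+n∸m≡n k x) (map-∸-+ k xs)

armVector : ℕ → List ℕ → List ℕ
armVector k λs = gaps (map (_∸ k) (take k λs))

legVector : ℕ → List ℕ → List ℕ
legVector k λs = mults 1 k (drop k λs)

length-legVector : ∀ k λs → length (legVector k λs) ≡ k
length-legVector k λs = length-mults 1 k (drop k λs)

take-glue : ∀ k ds vs → length ds ≡ k → take k (glue k ds vs) ≡ map (k +_) (suffixSums ds)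
take-glue k ds vs len =
  subst (λ l → take l (glue k ds vs) ≡ map (k +_) (suffixSums ds)) (length-shifted-arm k ds len)
    (take-length-++ (map (k +_) (suffixSums ds)) (expand 1 vs))

drop-glue : ∀ k ds vs → length ds ≡ k → drop k (glue k ds vs) ≡ expand 1 vs
drop-glue k ds vs len =
  subst (λ l → drop l (glue k ds vs) ≡ expand 1 vs) (length-shifted-arm k ds len)
    (drop-length-++ (map (k +_) (suffixSums ds)) (expand 1 vs))

arm-glue : ∀ k ds vs → length ds ≡ k → armVector k (glue k ds vs) ≡ ds
arm-glue k ds vs len = begin
  gaps (map (_∸ k) (take k (glue k ds vs)))    ≡⟨ cong (gaps ∘ map (_∸ k)) (take-glue k ds vs len) ⟩
  gaps (map (_∸ k) (map (k +_) (suffixSums ds))) ≡⟨ cong gaps (map-∸-+ k (suffixSums ds)) ⟩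
  gaps (suffixSums ds)                         ≡⟨ gaps-suffixSums ds ⟩
  ds ∎
  where open ≡-Reasoning

leg-glue : ∀ k ds vs → length ds ≡ k → length vs ≡ k → legVector k (glue k ds vs) ≡ vs
leg-glue k ds vs lends lenvs = begin
  mults 1 k (drop k (glue k ds vs))   ≡⟨ cong (mults 1 k) (drop-glue k ds vs lends) ⟩
  mults 1 k (expand 1 vs)             ≡⟨ cong (λ l → mults 1 l (expand 1 vs)) (sym lenvs) ⟩
  mults 1 (length vs) (expand 1 vs)   ≡⟨ mults-expand 1 vs ⟩
  vs ∎
  where open ≡-Reasoning

glue-split : ∀ {n k λs} → 1 ≤ k → IsPartitionOf n λs → DurfeeOrder λs k →
  length (armVector k λs) ≡ k × glue k (armVector k λs) (legVector k λs) ≡ λs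
glue-split {k = k} {λs} k≥1 (linked , positive , _) durfee =
  trans (length-gaps arm) (trans (length-map (_∸ k) top) (proj₁ blocks)) , glued
  where
  decreasing : Decreasing λs
  decreasing = linked⇒decreasing linked
  blocks : length (take k λs) ≡ k × All (k ≤_) (take k λs) × All (_≤ k) (drop k λs)
  blocks = blocks-of-durfee k≥1 decreasing durfee
  top arm : List ℕ
  top = take k λs
  arm = map (_∸ k) top
  arm-decreasing : Decreasing arm
  arm-decreasing = AllPairs.map⁺ (AllPairs.map (∸-monoˡ-≤ k) (AllPairs.take⁺ k decreasing))
  leg-expands : expand 1 (legVector k λs) ≡ drop k λs
  leg-expands = proj₁ (expand-mults-partition
    (decreasing⇒linked (AllPairs.drop⁺ k decreasing) , All.drop⁺ k positive , refl) (proj₂ (proj₂ blocks)))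
  glued : glue k (armVector k λs) (legVector k λs) ≡ λs
  glued = begin
    map (k +_) (suffixSums (gaps arm)) ++ expand 1 (legVector k λs)
      ≡⟨ cong₂ (λ a l → map (k +_) a ++ l) (suffixSums-gaps arm arm-decreasing) leg-expands ⟩
    map (k +_) arm ++ drop k λs
      ≡⟨ cong (_++ drop k λs) (map-+-∸ k top (proj₁ (proj₂ blocks))) ⟩
    take k λs ++ drop k λs
      ≡⟨ take++drop≡id k λs ⟩
    λs ∎
    where open ≡-Reasoning

SmallPartition : ℕ → ℕ → List ℕ → Set
SmallPartition n k μ = Σ ℕ λ N → N + k * k ≡ n × IsPartitionOf N μ × All (_≤ k) μ

assemble : ℕ → List ℕ → List ℕ → List ℕ
assemble k μ ds = glue k ds (zipWith _∸_ (mults 1 k μ) ds)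

core : ℕ → List ℕ → List ℕ
core k λs = expand 1 (zipWith _+_ (armVector k λs) (legVector k λs))

-- Each assembled list is a partition of n with Durfee square of order k: the square, arm
-- and leg contribute k² + Σ i·mᵢ(μ) = k² + (n − k²).
assemble-durfee : ∀ {n k μ ds} → 1 ≤ k → SmallPartition n k μ → Pointwise _≤_ ds (mults 1 k μ) →
  IsPartitionOf n (assemble k μ ds) × DurfeeOrder (assemble k μ ds) k
assemble-durfee {n} {k} {μ} {ds} k≥1 (N , N+k²≡n , μ-partition , μ≤k) ds≤m =
  subst (λ size → IsPartitionOf size (assemble k μ ds)) size≡n (proj₁ glued) , proj₂ glued
  where
  m : List ℕ
  m = mults 1 k μ
  lends : length ds ≡ k
  lends = trans (Pointwise-length ds≤m) (length-mults 1 k μ)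
  glued : IsPartitionOf (k * k + (moment 1 ds + moment 1 (zipWith _∸_ m ds))) (assemble k μ ds) ×
          DurfeeOrder (assemble k μ ds) k
  glued = glue-durfee ds (zipWith _∸_ m ds) k≥1 lends (trans (length-zipWith-∸ ds≤m) lends)
  size≡n : k * k + (moment 1 ds + moment 1 (zipWith _∸_ m ds)) ≡ n
  size≡n = begin
    k * k + (moment 1 ds + moment 1 (zipWith _∸_ m ds))
      ≡⟨ cong (k * k +_) (sym (moment-+ 1 ds (zipWith _∸_ m ds) (sym (length-zipWith-∸ ds≤m)))) ⟩
    k * k + moment 1 (zipWith _+_ ds (zipWith _∸_ m ds))
      ≡⟨ cong (λ v → k * k + moment 1 v) (zipWith-+-∸ ds≤m) ⟩
    k * k + moment 1 m  ≡⟨ cong (k * k +_) (proj₂ (expand-mults-partition μ-partition μ≤k)) ⟩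
    k * k + N           ≡⟨ +-comm (k * k) N ⟩
    N + k * k           ≡⟨ N+k²≡n ⟩
    n ∎
    where open ≡-Reasoning

decode-assemble : ∀ {n k μ ds} → SmallPartition n k μ → Pointwise _≤_ ds (mults 1 k μ) →
  armVector k (assemble k μ ds) ≡ ds × core k (assemble k μ ds) ≡ μ
decode-assemble {k = k} {μ} {ds} (_ , _ , μ-partition , μ≤k) ds≤m = arm≡ds , core≡μ
  where
  m : List ℕ
  m = mults 1 k μ
  lends : length ds ≡ k
  lends = trans (Pointwise-length ds≤m) (length-mults 1 k μ)
  arm≡ds : armVector k (assemble k μ ds) ≡ ds
  arm≡ds = arm-glue k ds (zipWith _∸_ m ds) lends
  leg≡ : legVector k (assemble k μ ds) ≡ zipWith _∸_ m ds
  leg≡ = leg-glue k ds (zipWith _∸_ m ds) lends (trans (length-zipWith-∸ ds≤m) lends)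
  core≡μ : core k (assemble k μ ds) ≡ μ
  core≡μ = begin
    expand 1 (zipWith _+_ (armVector k (assemble k μ ds)) (legVector k (assemble k μ ds)))
      ≡⟨ cong₂ (λ a l → expand 1 (zipWith _+_ a l)) arm≡ds leg≡ ⟩
    expand 1 (zipWith _+_ ds (zipWith _∸_ m ds))  ≡⟨ cong (expand 1) (zipWith-+-∸ ds≤m) ⟩
    expand 1 m                                    ≡⟨ proj₁ (expand-mults-partition μ-partition μ≤k) ⟩
    μ ∎
    where open ≡-Reasoning

split-durfee : ∀ {n k λs} → 1 ≤ k → IsPartitionOf n λs → DurfeeOrder λs k →
  SmallPartition n k (core k λs) × Pointwise _≤_ (armVector k λs) (mults 1 k (core k λs)) ×
  assemble k (core k λs) (armVector k λs) ≡ λs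
split-durfee {n} {k} {λs} k≥1 λ-partition@(_ , _ , sumλ) durfee =
  small , subst (Pointwise _≤_ ds) (sym mults-core) (≤-zipWith-+ ds vs len≡) , assembled
  where
  ds vs : List ℕ
  ds = armVector k λs
  vs = legVector k λs
  split : length ds ≡ k × glue k ds vs ≡ λs
  split = glue-split k≥1 λ-partition durfee
  len≡ : length ds ≡ length vs
  len≡ = trans (proj₁ split) (sym (length-legVector k λs))
  total : List ℕ
  total = zipWith _+_ ds vs
  len-total : length total ≡ k
  len-total = trans (length-zipWith-+ ds vs len≡) (proj₁ split)
  mults-core : mults 1 k (core k λs) ≡ total
  mults-core = subst (λ l → mults 1 l (expand 1 total) ≡ total) len-total (mults-expand 1 total)
  size : moment 1 total + k * k ≡ n
  size = begin
    moment 1 total + k * k                ≡⟨ +-comm (moment 1 total) (k * k) ⟩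
    k * k + moment 1 total                ≡⟨ cong (k * k +_) (moment-+ 1 ds vs len≡) ⟩
    k * k + (moment 1 ds + moment 1 vs)   ≡⟨ sym (sum-glue k ds vs (proj₁ split)) ⟩
    sum (glue k ds vs)                    ≡⟨ cong sum (proj₂ split) ⟩
    sum λs                                ≡⟨ sumλ ⟩
    n ∎
    where open ≡-Reasoning
  small : SmallPartition n k (core k λs)
  small = moment 1 total , size , proj₁ (expand-partition total) ,
          subst (λ l → All (_≤ l) (core k λs)) len-total (proj₂ (expand-partition total))
  assembled : assemble k (core k λs) ds ≡ λs
  assembled = begin
    glue k ds (zipWith _∸_ (mults 1 k (core k λs)) ds)
      ≡⟨ cong (λ m → glue k ds (zipWith _∸_ m ds)) mults-core ⟩
    glue k ds (zipWith _∸_ total ds)  ≡⟨ cong (glue k ds) (zipWith-∸-+ ds vs len≡) ⟩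
    glue k ds vs                      ≡⟨ proj₂ split ⟩
    λs ∎
    where open ≡-Reasoning

weight-mults : ∀ k μ → weight k μ ≡ product (map suc (mults 1 k μ))
weight-mults k μ = cong product (trans (map-applyUpTo (λ j → j) g k) (applyUpTo-mults k g (λ j → +-comm _ 1)))
  where
  g : ℕ → ℕ
  g j = mult (suc j) μ + 1
  applyUpTo-mults : ∀ {i} k (f : ℕ → ℕ) → (∀ j → f j ≡ suc (mult (i + j) μ)) →
    applyUpTo f k ≡ map suc (mults i k μ)
  applyUpTo-mults         zero    f f≡ = refl
  applyUpTo-mults {i} (suc k) f f≡ =
    cong₂ _∷_ (trans (f≡ 0) (cong (λ x → suc (mult x μ)) (+-identityʳ i)))
              (applyUpTo-mults {suc i} k (f ∘ suc) (λ j → trans (f≡ (suc j)) (cong (λ x → suc (mult x μ)) (+-suc i j))))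

fibre : ℕ → List ℕ → List (List ℕ)
fibre k μ = map (assemble k μ) (box (mults 1 k μ))

length-fibre : ∀ k μ → length (fibre k μ) ≡ weight k μ
length-fibre k μ =
  trans (length-map (assemble k μ) (box (mults 1 k μ))) (trans (length-box (mults 1 k μ)) (sym (weight-mults k μ)))

core-of-fibre : ∀ {n k μ λs} → SmallPartition n k μ → λs ∈ fibre k μ → core k λs ≡ μ
core-of-fibre {k = k} {μ} small λ∈ with ds , ds∈ , refl ← ∈-map⁻ (assemble k μ) λ∈ =
  proj₂ (decode-assemble small (∈-box⁻ (mults 1 k μ) ds∈))

fibre-durfee : ∀ {n k μ λs} → 1 ≤ k → SmallPartition n k μ → λs ∈ fibre k μ →
  IsPartitionOf n λs × DurfeeOrder λs k
fibre-durfee {k = k} {μ} k≥1 small λ∈ with ds , ds∈ , refl ← ∈-map⁻ (assemble k μ) λ∈ =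
  assemble-durfee k≥1 small (∈-box⁻ (mults 1 k μ) ds∈)

unique-fibres : ∀ {n k M} → Unique M → (∀ {μ} → μ ∈ M → SmallPartition n k μ) →
  Unique (concatMap (fibre k) M)
unique-fibres {k = k} {M} uM small = unique-concatMap uM unique-fibre disjoint
  where
  unique-fibre : ∀ {μ} → μ ∈ M → Unique (fibre k μ)
  unique-fibre {μ} μ∈ = unique-map-on (unique-box (mults 1 k μ)) λ ds∈ es∈ same →
    trans (sym (arm-of ds∈)) (trans (cong (armVector k) same) (arm-of es∈))
    where
    arm-of : ∀ {ds} → ds ∈ box (mults 1 k μ) → armVector k (assemble k μ ds) ≡ ds
    arm-of ds∈ = proj₁ (decode-assemble (small μ∈) (∈-box⁻ (mults 1 k μ) ds∈))
  disjoint : ∀ {μ μ' λs} → μ ∈ M → μ' ∈ M → λs ∈ fibre k μ → λs ∈ fibre k μ' → μ ≡ μ'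
  disjoint μ∈ μ'∈ p q = trans (sym (core-of-fibre (small μ∈) p)) (core-of-fibre (small μ'∈) q)

∈-fibres⇔ : ∀ {n k M} → 1 ≤ k → (∀ μ → μ ∈ M ⇔ SmallPartition n k μ) →
  ∀ {λs} → λs ∈ concatMap (fibre k) M ⇔ (IsPartitionOf n λs × DurfeeOrder λs k)
∈-fibres⇔ {n} {k} {M} k≥1 M-spec {λs} = mk⇔ to from
  where
  to : λs ∈ concatMap (fibre k) M → IsPartitionOf n λs × DurfeeOrder λs k
  to λ∈ with μ , μ∈ , λ∈fibre ← find (∈-concatMap⁻ (fibre k) λ∈) =
    fibre-durfee k≥1 (Equivalence.to (M-spec μ) μ∈) λ∈fibre
  from : IsPartitionOf n λs × DurfeeOrder λs k → λs ∈ concatMap (fibre k) M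
  from (λ-partition , durfee) with small , arm≤ , assembled ← split-durfee k≥1 λ-partition durfee =
    ∈-concatMap⁺ (fibre k) (lose (Equivalence.from (M-spec (core k λs)) small)
      (subst (_∈ fibre k (core k λs)) assembled (∈-map⁺ (assemble k (core k λs)) (∈-box⁺ arm≤))))

mainTheorem1 : (n k : ℕ) → 1 ≤ k →
    (L M : List (List ℕ)) →
    Unique L → (∀ λs → (λs ∈ L) ⇔ (IsPartitionOf n λs × DurfeeOrder λs k)) →
    Unique M → (∀ μ → (μ ∈ M) ⇔ (Σ ℕ λ N → N + k * k ≡ n × IsPartitionOf N μ × All (_≤ k) μ)) →
    length L ≡ sum (map (weight k) M)
mainTheorem1 n k k≥1 L M uL L-spec uM M-spec = begin
  length L
    ≡⟨ length-unique-≡ uL (unique-fibres uM (Equivalence.to (M-spec _)))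
         (Eq.trans (L-spec _) (Eq.sym (∈-fibres⇔ k≥1 M-spec))) ⟩
  length (concatMap (fibre k) M)          ≡⟨ length-concatMap (fibre k) M ⟩
  sum (map (length ∘ fibre k) M)          ≡⟨ cong sum (map-cong (length-fibre k) M) ⟩
  sum (map (weight k) M) ∎
  where open ≡-Reasoning
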